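{- In $\mathbf{MRel}$ every isomorphism is linear: if $f\in\mathbf{MRel}(B,A)$ and $g\in\mathbf{MRel}(A,B)$ satisfy $f\circ g=\mathrm{Id}_A$ and $g\circ f=\mathrm{Id}_B$, then $D(f)=f\circ\pi_1$ and $D(g)=g\circ\pi_1$.
   Context: $\mathbf{MRel}$: objects are sets; $\mathbf{MRel}(A,B)=\mathcal{P}(\mathcal{M}_f(A)\times B)$ with $\mathcal{M}_f(A)$ the finite multisets over $A$; identity $\mathrm{Id}_A=\{([\alpha],\alpha)\mid\alpha\in A\}$; composition $t\circ s=\{(m,\gamma)\mid\exists(m_1,\beta_1),\dots,(m_k,\beta_k)\in s,\ m=m_1\uplus\cdots\uplus m_k,\ ([\beta_1,\dots,\beta_k],\gamma)\in t\}$. Product $A_1\& A_2=(\{1\}\times A_1)\cup(\{2\}\times A_2)$, $\mathcal{M}_f(A_1\&A_2)$ identified with $\mathcal{M}_f(A_1)\times\mathcal{M}_f(A_2)$, projections $\pi_i=\{([(i,a)],a)\mid a\in A_i\}$. Derivative: $D(f)=\{(([\alpha],m),\beta)\mid(m\uplus[\alpha],\beta)\in f\}$. -}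

module Defs where

open import Data.List using (List; []; _∷_; [_]; _++_; map; concat)
open import Data.List.Relation.Unary.All using (All)
open import Data.List.Relation.Binary.Permutation.Propositional using (_↭_)
open import Data.Product using (Σ; _×_; _,_; proj₁; proj₂; ∃-syntax)
open import Data.Sum using (_⊎_; inj₁; inj₂)

-- Finite multisets over A are represented by lists over A taken up to
-- permutation (_↭_).  A morphism of MRel(A,B) is a subset of M_f(A) × B,
-- i.e. a predicate on List A × B that is invariant under permutation.

Rel : Set → Set → Set₁
Rel A B = List A → B → Set

Respects↭ : {A B : Set} → Rel A B → Set
Respects↭ {A} {B} f = ∀ {m m' : List A} {b : B} → m ↭ m' → f m b → f m' b

_≐_ : {A B : Set} → Rel A B → Rel A B → Set
_≐_ {A} {B} f g = ∀ (m : List A) (b : B) → (f m b → g m b) × (g m b → f m b)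

infix 4 _≐_

Id : (A : Set) → Rel A A
Id A m α = m ↭ [ α ]

_∘ᴹ_ : {A B C : Set} → Rel B C → Rel A B → Rel A C
_∘ᴹ_ {A} {B} {C} t s m γ =
  ∃[ ps ] (All (λ p → s (proj₁ p) (proj₂ p)) ps
           × (m ↭ concat (map proj₁ ps))
           × t (map proj₂ ps) γ)

infixr 9 _∘ᴹ_

-- product A₁ & A₂ = ({1} × A₁) ∪ ({2} × A₂), encoded as a disjoint sum
_&_ : Set → Set → Set
A₁ & A₂ = A₁ ⊎ A₂

π₁ : {A₁ A₂ : Set} → Rel (A₁ & A₂) A₁
π₁ m a = m ↭ [ inj₁ a ]

-- derivative D(f) = { (([α], m), β) | (m ⊎ [α], β) ∈ f }, where a multiset
-- over A & A corresponds to the pair (its inj₁ part, its inj₂ part)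
D : {A B : Set} → Rel A B → Rel (A & A) B
D {A} f n β =
  ∃[ α ] ∃[ m ] ((n ↭ (inj₁ α ∷ map inj₂ m)) × f (m ++ [ α ]) β)

module Submission where

open import Defs
open import Data.List using (List; []; _∷_; [_]; _++_; map; concat; length)
open import Data.List.Properties using (length-++; ++-identityʳ; ++-conicalʳ; ∷-injectiveʳ)
open import Data.List.Relation.Unary.All using (All; []; _∷_)
open import Data.List.Relation.Binary.Permutation.Propositional
  using (_↭_; ↭-refl; ↭-reflexive; ↭-trans)
open import Data.List.Relation.Binary.Permutation.Propositional.Properties using (↭-length)
open import Data.Nat using (_≤_; z≤n; s≤s)
open import Data.Nat.Properties using (+-mono-≤; ≤-trans; ≤-reflexive)
open import Data.Product using (_×_; _,_; proj₁; proj₂; ∃-syntax)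
open import Data.Sum using (inj₁)
open import Relation.Binary.PropositionalEquality using (_≡_; refl; sym; cong; subst)

-- An isomorphism f : B → A sends singletons to singletons.  Every b has a
-- nonempty multiset of preimages under g, since ([b], b) ∈ g ∘ f; so if
-- (m, a) ∈ f then (n, a) ∈ f ∘ g = Id for some n with |n| ≥ |m|, forcing
-- |m| ≤ 1, while m = [] would put ([], a) in f ∘ g.  A relation supported
-- on singletons only ever sees [α] in D(f), which is then f ∘ π₁.

_⊆ᴹ_ : {A B : Set} → Rel A B → Rel A B → Set
_⊆ᴹ_ {A} {B} f g = ∀ {m : List A} {b : B} → f m b → g m b

infix 4 _⊆ᴹ_

≐⇒⊆ᴹ : {A B : Set} {f g : Rel A B} → f ≐ g → f ⊆ᴹ g
≐⇒⊆ᴹ f≐g = proj₁ (f≐g _ _)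

≐⇒⊇ᴹ : {A B : Set} {f g : Rel A B} → f ≐ g → g ⊆ᴹ f
≐⇒⊇ᴹ f≐g = proj₂ (f≐g _ _)

Linear : {A B : Set} → Rel A B → Set
Linear {A} {B} f = ∀ {m : List A} {b : B} → f m b → ∃[ a ] m ≡ [ a ]

linear⇒D≐∘π₁ : {A B : Set} (f : Rel A B) → Linear f → D f ≐ f ∘ᴹ π₁
linear⇒D≐∘π₁ f linear n β = to , from
  where
  to : D f n β → (f ∘ᴹ π₁) n β
  to (α , [] , n↭ , fβ) = [ ([ inj₁ α ] , α) ] , ↭-refl ∷ [] , n↭ , fβ
  to (α , x ∷ m , _ , fβ) with linear fβ
  ... | _ , eq with ++-conicalʳ m [ α ] (∷-injectiveʳ eq)
  ... | ()

  from : (f ∘ᴹ π₁) n β → D f n β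
  from ([] , _ , _ , fβ) with linear fβ
  ... | _ , ()
  from ((k , α) ∷ [] , k↭ ∷ [] , n↭ , fβ) =
    α , [] , ↭-trans n↭ (↭-trans (↭-reflexive (++-identityʳ k)) k↭) , fβ
  from (_ ∷ _ ∷ _ , _ , _ , fβ) with linear fβ
  ... | _ , ()

module _ {A B : Set} (f : Rel B A) (g : Rel A B)
         (fg⊆Id : f ∘ᴹ g ⊆ᴹ Id A) (Id⊆gf : Id B ⊆ᴹ g ∘ᴹ f) where

  nonempty-preimage : ∀ b → ∃[ n ] g n b × 1 ≤ length n
  nonempty-preimage b with Id⊆gf {[ b ]} ↭-refl
  ... | [] , _ , b↭[] , _ with ↭-length b↭[]
  ...   | ()
  nonempty-preimage b | _ ∷ ps , _ , _ , gnb = _ , gnb , s≤s z≤n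

  preimages : ∀ m → ∃[ qs ] All (λ q → g (proj₁ q) (proj₂ q)) qs
                          × map proj₂ qs ≡ m
                          × length m ≤ length (concat (map proj₁ qs))
  preimages [] = [] , [] , refl , z≤n
  preimages (b ∷ m) with nonempty-preimage b | preimages m
  ... | n , gnb , 1≤n | qs , gqs , qs↦m , m≤qs =
    (n , b) ∷ qs , gnb ∷ gqs , cong (b ∷_) qs↦m ,
    ≤-trans (+-mono-≤ 1≤n m≤qs) (≤-reflexive (sym (length-++ n)))

  length≤1 : ∀ {m a} → f m a → length m ≤ 1
  length≤1 {m} {a} fma with preimages m
  ... | qs , gqs , qs↦m , m≤qs =
    ≤-trans m≤qs (≤-reflexive (↭-length (fg⊆Id (qs , gqs , ↭-refl , fqs))))
    where
    fqs : f (map proj₂ qs) a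
    fqs = subst (λ x → f x a) (sym qs↦m) fma

  inverse⇒linear : Linear f
  inverse⇒linear {[]} {a} fa with ↭-length (fg⊆Id ([] , [] , ↭-refl , fa))
  ... | ()
  inverse⇒linear {b ∷ []} _ = b , refl
  inverse⇒linear {_ ∷ _ ∷ _} fm with length≤1 fm
  ... | s≤s ()

corollary5p6 : (A B : Set) (f : Rel B A) (g : Rel A B) →
    Respects↭ f → Respects↭ g →
    (f ∘ᴹ g) ≐ Id A → (g ∘ᴹ f) ≐ Id B →
    (D f ≐ f ∘ᴹ π₁) × (D g ≐ g ∘ᴹ π₁)
corollary5p6 A B f g _ _ fg≐Id gf≐Id =
  linear⇒D≐∘π₁ f (inverse⇒linear f g (≐⇒⊆ᴹ fg≐Id) (≐⇒⊇ᴹ gf≐Id)) ,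
  linear⇒D≐∘π₁ g (inverse⇒linear g f (≐⇒⊆ᴹ gf≐Id) (≐⇒⊇ᴹ fg≐Id))
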